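{- Let $(g(x),f(x))$ be a Riordan array over a commutative ring $R$, with $f(x)=f_1x+f_2x^2+f_3x^3+\cdots$. Let $\left(g(x),\frac{f(x)}{x}\right)$ denote its rectification, i.e. the square matrix $(r_{n,k})_{n,k\ge0}$ with $r_{n,k}=[x^n]\,g(x)\left(\frac{f(x)}{x}\right)^k$ (equivalently, bivariate generating function $\frac{g(x)}{1-y\,f(x)/x}$). For $a\in R$ let $\mathbf{B}_a$ be the lower-triangular matrix $\left(\binom{n}{k}a^{n-k}\right)_{n,k\ge0}$, i.e. the Riordan array $\left(\frac{1}{1-ax},\frac{x}{1-ax}\right)$, so that $\mathbf{B}_{a}^{ -1}=\mathbf{B}_{ -a}$. If $f_2\neq 0$, then the matrix product $$\left(g(x),\frac{f(x)}{x}\right)\cdot\left(\mathbf{B}_{f_1}^{ -1}\right)^T$$ is a Riordan array.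
   Context: A Riordan array $(g(x),f(x))$ over $R$ is given by power series $g(x)=\sum_{n\ge0}g_nx^n$ with $g_0\neq0$ and $f(x)=\sum_{n\ge1}f_nx^n$ with $f_1\neq 0$; it is the lower-triangular matrix $(t_{n,k})_{n,k\ge0}$ with $t_{n,k}=[x^n]\,g(x)f(x)^k$, where $[x^n]$ extracts the coefficient of $x^n$. $M^T$ denotes the transpose of a matrix $M$. -}

module Defs where

open import Level using (_⊔_)
open import Algebra.Bundles using (CommutativeRing)
open import Data.Nat using (ℕ; zero; suc; _∸_; _≤?_)
open import Data.Nat.Combinatorics using (_C_)
open import Data.Product using (Σ; _×_)
open import Relation.Nullary using (¬_; yes; no)

module _ {c ℓ} (R : CommutativeRing c ℓ) where
  open CommutativeRing R

  Series : Set c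
  Series = ℕ → Carrier

  -- infinite matrices over R, indexed (row n, column k)
  Matrix : Set c
  Matrix = ℕ → ℕ → Carrier

  sumTo : (ℕ → Carrier) → ℕ → Carrier
  sumTo h zero    = 0#
  sumTo h (suc n) = sumTo h n + h n

  fromℕ : ℕ → Carrier
  fromℕ zero    = 0#
  fromℕ (suc n) = 1# + fromℕ n

  pow : Carrier → ℕ → Carrier
  pow a zero    = 1#
  pow a (suc n) = a * pow a n

  oneS : Series
  oneS zero    = 1#
  oneS (suc _) = 0#

  mulS : Series → Series → Series
  mulS p q n = sumTo (λ i → p i * q (n ∸ i)) (suc n)

  powS : Series → ℕ → Series
  powS p zero    = oneS
  powS p (suc k) = mulS p (powS p k)

  divX : Series → Series
  divX f n = f (suc n)

  arrayOf : Series → Series → Matrix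
  arrayOf g h n k = mulS g (powS h k) n

  IsRiordan : Matrix → Set (c ⊔ ℓ)
  IsRiordan M = Σ Series λ g → Σ Series λ f →
    (¬ (g 0 ≈ 0#)) × (f 0 ≈ 0#) × (¬ (f 1 ≈ 0#)) ×
    (∀ n k → M n k ≈ arrayOf g f n k)

  rectification : Series → Series → Matrix
  rectification g f = arrayOf g (divX f)

  binomialMatrix : Carrier → Matrix
  binomialMatrix a n k with k ≤? n
  ... | yes _ = fromℕ (n C k) * pow a (n ∸ k)
  ... | no  _ = 0#

  transpose : Matrix → Matrix
  transpose M n k = M k n

  -- product M · U where U is upper triangular (U j k = 0 for j > k),
  -- so (M · U)_{n,k} = Σ_{j ≤ k} M_{n,j} U_{j,k} (a finite sum)
  mulUpper : Matrix → Matrix → Matrix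
  mulUpper M U n k = sumTo (λ j → M n j * U j k) (suc k)

{-# OPTIONS --safe #-}
-- Write b = - f₁ and p = f/x.  Column k of the product is
-- Σⱼ C(k,j) b^(k-j) · g pʲ = g · (p + b)ᵏ by the binomial theorem, so the
-- product is the Riordan array (g, f/x - f₁); the constant term of f/x - f₁
-- is 0 and its linear coefficient is f₂ ≠ 0.
module Submission where

open import Defs
open import Algebra.Bundles using (CommutativeRing)
open import Relation.Nullary using (¬_; yes; no; contradiction)
open import Data.Nat as ℕ using (ℕ; zero; suc; _∸_; _<_; _≤_; _≤?_)
open import Data.Nat.Properties using (m<n⇒m<1+n; ≤-refl; ≤-pred; n<1+n; ≰⇒>; +-∸-assoc)
open import Data.Nat.Combinatorics using (_C_; nCk+nC[k+1]≡[n+1]C[k+1])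
open import Data.Nat.Combinatorics.Specification using (k>n⇒nCk≡0)
open import Data.Product using (_,_)
open import Relation.Binary.PropositionalEquality as ≡ using (_≡_)
import Algebra.Properties.CommutativeSemigroup as CommSemigroupProperties
import Relation.Binary.Reasoning.Setoid as SetoidReasoning

module _ {c ℓ} (R : CommutativeRing c ℓ) where
  open CommutativeRing R
  open CommSemigroupProperties +-commutativeSemigroup
    using (interchange) renaming (x∙yz≈y∙xz to x+yz≈y+xz)
  open CommSemigroupProperties *-commutativeSemigroup
    using () renaming (x∙yz≈y∙xz to x*yz≈y*xz)
  open SetoidReasoning setoid

  sumTo-cong< : ∀ {h h′} n → (∀ j → j < n → h j ≈ h′ j) →
                sumTo R h n ≈ sumTo R h′ n
  sumTo-cong< zero    h≈h′ = refl
  sumTo-cong< (suc n) h≈h′ =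
    +-cong (sumTo-cong< n (λ j j<n → h≈h′ j (m<n⇒m<1+n j<n))) (h≈h′ n ≤-refl)

  sumTo-cong : ∀ {h h′} n → (∀ j → h j ≈ h′ j) → sumTo R h n ≈ sumTo R h′ n
  sumTo-cong n h≈h′ = sumTo-cong< n (λ j _ → h≈h′ j)

  sumTo-zero : ∀ n → sumTo R (λ _ → 0#) n ≈ 0#
  sumTo-zero zero    = refl
  sumTo-zero (suc n) = trans (+-congʳ (sumTo-zero n)) (+-identityˡ 0#)

  sumTo-distrib-+ : ∀ h h′ n →
    sumTo R (λ j → h j + h′ j) n ≈ sumTo R h n + sumTo R h′ n
  sumTo-distrib-+ h h′ zero    = sym (+-identityˡ 0#)
  sumTo-distrib-+ h h′ (suc n) =
    trans (+-congʳ (sumTo-distrib-+ h h′ n)) (interchange _ _ _ _)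

  *-distribˡ-sumTo : ∀ x h n → x * sumTo R h n ≈ sumTo R (λ j → x * h j) n
  *-distribˡ-sumTo x h zero    = zeroʳ x
  *-distribˡ-sumTo x h (suc n) = trans (distribˡ x _ _) (+-congʳ (*-distribˡ-sumTo x h n))

  *-distribʳ-sumTo : ∀ x h n → sumTo R h n * x ≈ sumTo R (λ j → h j * x) n
  *-distribʳ-sumTo x h zero    = zeroˡ x
  *-distribʳ-sumTo x h (suc n) = trans (distribʳ x _ _) (+-congʳ (*-distribʳ-sumTo x h n))

  sumTo-comm : ∀ (F : ℕ → ℕ → Carrier) m n →
    sumTo R (λ i → sumTo R (F i) n) m ≈ sumTo R (λ j → sumTo R (λ i → F i j) m) n
  sumTo-comm F zero    n = sym (sumTo-zero n)
  sumTo-comm F (suc m) n =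
    trans (+-congʳ (sumTo-comm F m n)) (sym (sumTo-distrib-+ _ (F m) n))

  sumTo-head : ∀ h n → sumTo R h (suc n) ≈ h 0 + sumTo R (λ j → h (suc j)) n
  sumTo-head h zero    = +-comm 0# (h 0)
  sumTo-head h (suc n) = trans (+-congʳ (sumTo-head h n)) (+-assoc _ _ _)

  fromℕ-+ : ∀ m n → fromℕ R (m ℕ.+ n) ≈ fromℕ R m + fromℕ R n
  fromℕ-+ zero    n = sym (+-identityˡ _)
  fromℕ-+ (suc m) n = trans (+-congˡ (fromℕ-+ m n)) (sym (+-assoc _ _ _))

  mulS-congʳ : ∀ p {q q′} → (∀ m → q m ≈ q′ m) →
               ∀ n → mulS R p q n ≈ mulS R p q′ n
  mulS-congʳ p q≈q′ n = sumTo-cong (suc n) (λ i → *-congˡ (q≈q′ (n ∸ i)))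

  mulS-oneSˡ : ∀ q n → mulS R (oneS R) q n ≈ q n
  mulS-oneSˡ q n = begin
    mulS R (oneS R) q n
      ≈⟨ sumTo-head _ n ⟩
    1# * q n + sumTo R (λ j → 0# * q (n ∸ suc j)) n
      ≈⟨ +-cong (*-identityˡ _) (sumTo-cong n (λ _ → zeroˡ _)) ⟩
    q n + sumTo R (λ _ → 0#) n
      ≈⟨ +-congˡ (sumTo-zero n) ⟩
    q n + 0#
      ≈⟨ +-identityʳ _ ⟩
    q n
      ∎

  mulS-sumToʳ : ∀ p (q : ℕ → Series R) (a : ℕ → Carrier) N n →
    mulS R p (λ m → sumTo R (λ j → q j m * a j) N) n
      ≈ sumTo R (λ j → mulS R p (q j) n * a j) N
  mulS-sumToʳ p q a N n = begin
    sumTo R (λ i → p i * sumTo R (λ j → q j (n ∸ i) * a j) N) (suc n)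
      ≈⟨ sumTo-cong (suc n) (λ i → *-distribˡ-sumTo (p i) _ N) ⟩
    sumTo R (λ i → sumTo R (λ j → p i * (q j (n ∸ i) * a j)) N) (suc n)
      ≈⟨ sumTo-cong (suc n) (λ i → sumTo-cong N (λ j → sym (*-assoc _ _ _))) ⟩
    sumTo R (λ i → sumTo R (λ j → (p i * q j (n ∸ i)) * a j) N) (suc n)
      ≈⟨ sumTo-comm _ (suc n) N ⟩
    sumTo R (λ j → sumTo R (λ i → (p i * q j (n ∸ i)) * a j) (suc n)) N
      ≈⟨ sumTo-cong N (λ j → sym (*-distribʳ-sumTo (a j) _ (suc n))) ⟩
    sumTo R (λ j → mulS R p (q j) n * a j) N
      ∎

  addConst : Carrier → Series R → Series R
  addConst b p n = p n + b * oneS R n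

  mulS-addConstˡ : ∀ b p q n → mulS R (addConst b p) q n ≈ mulS R p q n + b * q n
  mulS-addConstˡ b p q n = begin
    sumTo R (λ i → (p i + b * oneS R i) * q (n ∸ i)) (suc n)
      ≈⟨ sumTo-cong (suc n) (λ i → trans (distribʳ _ _ _) (+-congˡ (*-assoc _ _ _))) ⟩
    sumTo R (λ i → p i * q (n ∸ i) + b * (oneS R i * q (n ∸ i))) (suc n)
      ≈⟨ sumTo-distrib-+ _ _ (suc n) ⟩
    mulS R p q n + sumTo R (λ i → b * (oneS R i * q (n ∸ i))) (suc n)
      ≈⟨ +-congˡ (sym (*-distribˡ-sumTo b _ (suc n))) ⟩
    mulS R p q n + b * mulS R (oneS R) q n
      ≈⟨ +-congˡ (*-congˡ (mulS-oneSˡ q n)) ⟩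
    mulS R p q n + b * q n
      ∎

  -- The entry of binomialMatrix on and below the diagonal; as k C j = 0 for
  -- j > k it also vanishes above it, so it needs no case split on j ≤ k.
  binomialEntry : Carrier → ℕ → ℕ → Carrier
  binomialEntry b k j = fromℕ R (k C j) * pow R b (k ∸ j)

  binomialMatrix-≤ : ∀ b {k j} → j ≤ k → binomialMatrix R b k j ≡ binomialEntry b k j
  binomialMatrix-≤ b {k} {j} j≤k with j ≤? k
  ... | yes _   = ≡.refl
  ... | no  j≰k = contradiction j≤k j≰k

  binomialEntry-above : ∀ b {k j} → k < j → binomialEntry b k j ≈ 0#
  binomialEntry-above b k<j =
    trans (*-congʳ (reflexive (≡.cong (fromℕ R) (k>n⇒nCk≡0 k<j)))) (zeroˡ _)

  binomialEntry-suc-zero : ∀ b k → binomialEntry b (suc k) 0 ≈ b * binomialEntry b k 0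
  binomialEntry-suc-zero b k = x*yz≈y*xz _ _ _

  *-binomialEntry-suc : ∀ b k j →
    b * binomialEntry b k (suc j) ≈ fromℕ R (k C suc j) * pow R b (k ∸ j)
  *-binomialEntry-suc b k j with suc j ≤? k
  ... | yes j<k = trans (x*yz≈y*xz _ _ _)
    (reflexive (≡.cong (λ e → fromℕ R (k C suc j) * pow R b e)
                       (≡.sym (+-∸-assoc 1 j<k))))
  ... | no  j≮k = begin
    b * binomialEntry b k (suc j)
      ≈⟨ *-congˡ (binomialEntry-above b k<sj) ⟩
    b * 0#
      ≈⟨ zeroʳ b ⟩
    0#
      ≈⟨ zeroˡ _ ⟨
    fromℕ R 0 * pow R b (k ∸ j)
      ≡⟨ ≡.cong (λ e → fromℕ R e * pow R b (k ∸ j)) (k>n⇒nCk≡0 k<sj) ⟨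
    fromℕ R (k C suc j) * pow R b (k ∸ j)
      ∎
    where
    k<sj : k < suc j
    k<sj = ≰⇒> j≮k

  binomialEntry-pascal : ∀ b k j →
    binomialEntry b (suc k) (suc j) ≈ binomialEntry b k j + b * binomialEntry b k (suc j)
  binomialEntry-pascal b k j = begin
    fromℕ R (suc k C suc j) * pow R b (k ∸ j)
      ≡⟨ ≡.cong (λ e → fromℕ R e * pow R b (k ∸ j)) (nCk+nC[k+1]≡[n+1]C[k+1] k j) ⟨
    fromℕ R (k C j ℕ.+ k C suc j) * pow R b (k ∸ j)
      ≈⟨ *-congʳ (fromℕ-+ (k C j) (k C suc j)) ⟩
    (fromℕ R (k C j) + fromℕ R (k C suc j)) * pow R b (k ∸ j)
      ≈⟨ distribʳ _ _ _ ⟩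
    binomialEntry b k j + fromℕ R (k C suc j) * pow R b (k ∸ j)
      ≈⟨ +-congˡ (*-binomialEntry-suc b k j) ⟨
    binomialEntry b k j + b * binomialEntry b k (suc j)
      ∎

  binomialTransform : Carrier → ℕ → (ℕ → Carrier) → Carrier
  binomialTransform b k a = sumTo R (λ j → a j * binomialEntry b k j) (suc k)

  binomialTransform-overshoot : ∀ b k a →
    sumTo R (λ j → a j * binomialEntry b k j) (suc (suc k)) ≈ binomialTransform b k a
  binomialTransform-overshoot b k a = begin
    binomialTransform b k a + a (suc k) * binomialEntry b k (suc k)
      ≈⟨ +-congˡ (*-congˡ (binomialEntry-above b (n<1+n k))) ⟩
    binomialTransform b k a + a (suc k) * 0#
      ≈⟨ +-congˡ (zeroʳ _) ⟩
    binomialTransform b k a + 0#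
      ≈⟨ +-identityʳ _ ⟩
    binomialTransform b k a
      ∎

  binomialTransform-suc : ∀ b k a →
    binomialTransform b (suc k) a
      ≈ binomialTransform b k (λ j → a (suc j)) + b * binomialTransform b k a
  binomialTransform-suc b k a = begin
    binomialTransform b (suc k) a
      ≈⟨ sumTo-head _ (suc k) ⟩
    a 0 * binomialEntry b (suc k) 0
      + sumTo R (λ j → a (suc j) * binomialEntry b (suc k) (suc j)) (suc k)
      ≈⟨ +-cong head (sumTo-cong (suc k) step) ⟩
    b * x + sumTo R (λ j → a (suc j) * binomialEntry b k j + b * y j) (suc k)
      ≈⟨ +-congˡ (sumTo-distrib-+ _ _ (suc k)) ⟩
    b * x + (binomialTransform b k (λ j → a (suc j)) + sumTo R (λ j → b * y j) (suc k))
      ≈⟨ x+yz≈y+xz _ _ _ ⟩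
    binomialTransform b k (λ j → a (suc j)) + (b * x + sumTo R (λ j → b * y j) (suc k))
      ≈⟨ +-congˡ (+-congˡ (*-distribˡ-sumTo b y (suc k))) ⟨
    binomialTransform b k (λ j → a (suc j)) + (b * x + b * sumTo R y (suc k))
      ≈⟨ +-congˡ (distribˡ b x _) ⟨
    binomialTransform b k (λ j → a (suc j)) + b * (x + sumTo R y (suc k))
      ≈⟨ +-congˡ (*-congˡ (trans (sym (sumTo-head _ (suc k)))
                                 (binomialTransform-overshoot b k a))) ⟩
    binomialTransform b k (λ j → a (suc j)) + b * binomialTransform b k a
      ∎
    where
    x : Carrier
    x = a 0 * binomialEntry b k 0
    y : ℕ → Carrier
    y j = a (suc j) * binomialEntry b k (suc j)
    head : a 0 * binomialEntry b (suc k) 0 ≈ b * x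
    head = trans (*-congˡ (binomialEntry-suc-zero b k)) (x*yz≈y*xz _ _ _)
    step : ∀ j → a (suc j) * binomialEntry b (suc k) (suc j)
                 ≈ a (suc j) * binomialEntry b k j + b * y j
    step j = trans (*-congˡ (binomialEntry-pascal b k j))
                   (trans (distribˡ _ _ _) (+-congˡ (x*yz≈y*xz _ _ _)))

  powS-addConst : ∀ b p k m →
    powS R (addConst b p) k m ≈ binomialTransform b k (λ j → powS R p j m)
  powS-addConst b p zero    m = sym (begin
    0# + oneS R m * ((1# + 0#) * 1#)  ≈⟨ +-identityˡ _ ⟩
    oneS R m * ((1# + 0#) * 1#)       ≈⟨ *-congˡ (trans (*-identityʳ _) (+-identityʳ _)) ⟩
    oneS R m * 1#                     ≈⟨ *-identityʳ _ ⟩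
    oneS R m                          ∎)
  powS-addConst b p (suc k) m = begin
    mulS R (addConst b p) (powS R (addConst b p) k) m
      ≈⟨ mulS-addConstˡ b p (powS R (addConst b p) k) m ⟩
    mulS R p (powS R (addConst b p) k) m + b * powS R (addConst b p) k m
      ≈⟨ +-cong (mulS-congʳ p (powS-addConst b p k) m) (*-congˡ (powS-addConst b p k m)) ⟩
    mulS R p (λ n → binomialTransform b k (λ j → powS R p j n)) m
      + b * binomialTransform b k (λ j → powS R p j m)
      ≈⟨ +-congʳ (mulS-sumToʳ p (powS R p) (binomialEntry b k) (suc k) m) ⟩
    binomialTransform b k (λ j → powS R p (suc j) m)
      + b * binomialTransform b k (λ j → powS R p j m)
      ≈⟨ binomialTransform-suc b k (λ j → powS R p j m) ⟨
    binomialTransform b (suc k) (λ j → powS R p j m)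
      ∎

  rectification-*-binomialMatrixᵀ : ∀ b g f n k →
    mulUpper R (rectification R g f) (transpose R (binomialMatrix R b)) n k
      ≈ arrayOf R g (addConst b (divX R f)) n k
  rectification-*-binomialMatrixᵀ b g f n k = begin
    sumTo R (λ j → mulS R g (powS R p j) n * binomialMatrix R b k j) (suc k)
      ≈⟨ sumTo-cong< (suc k) (λ j j<1+k → reflexive
           (≡.cong (mulS R g (powS R p j) n *_) (binomialMatrix-≤ b (≤-pred j<1+k)))) ⟩
    sumTo R (λ j → mulS R g (powS R p j) n * binomialEntry b k j) (suc k)
      ≈⟨ mulS-sumToʳ g (powS R p) (binomialEntry b k) (suc k) n ⟨
    mulS R g (λ m → binomialTransform b k (λ j → powS R p j m)) n
      ≈⟨ mulS-congʳ g (powS-addConst b p k) n ⟨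
    mulS R g (powS R (addConst b p) k) n
      ∎
    where
    p : Series R
    p = divX R f

mainTheorem2 : ∀ {c ℓ} (R : CommutativeRing c ℓ) → let open CommutativeRing R in
    (g f : Series R) →
    ¬ (g 0 ≈ 0#) → f 0 ≈ 0# → ¬ (f 1 ≈ 0#) →
    ¬ (f 2 ≈ 0#) →
    IsRiordan R (mulUpper R (rectification R g f)
                             (transpose R (binomialMatrix R (- (f 1)))))
mainTheorem2 R g f g₀≉0 _ _ f₂≉0 =
  g , h , g₀≉0 , h₀≈0 , h₁≉0 , rectification-*-binomialMatrixᵀ R (- f 1) g f
  where
  open CommutativeRing R
  h : Series R
  h = addConst R (- f 1) (divX R f)
  h₀≈0 : h 0 ≈ 0#
  h₀≈0 = trans (+-congˡ (*-identityʳ _)) (-‿inverseʳ (f 1))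
  h₁≉0 : ¬ (h 1 ≈ 0#)
  h₁≉0 h₁≈0 = f₂≉0 (trans (sym (trans (+-congˡ (zeroʳ _)) (+-identityʳ _))) h₁≈0)
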